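{- Let $G$ be a graph and let $(H,\varphi_H)$ be a tidy $IG$. If $R \subseteq G$ is a ray, then the pullback $H(R)$ is also a ray.
   Context: An inflated copy of $G$ (an $IG$) is a pair $(H,\varphi_H)$ with $H$ a graph and $\varphi_H\colon V(H)\to V(G)$ such that each branch set $H(v)=\varphi_H^{ -1}(v)$ induces a non-empty connected subgraph of $H$, and there is an edge of $H$ between $H(v)$ and $H(w)$ iff $vw\in E(G)$, and this edge, if it exists, is unique. The $IG$ is tidy if $H$ is subgraph-minimal with this property, i.e. $(H',\varphi_H\restriction V(H'))$ is not an $IG$ for any $H'\subsetneq H$. For a subgraph $M\subseteq G$ without isolated vertices, the pullback of $M$ to a tidy $IG$ $H$ is the $IM$ $(H(M),\varphi_H\restriction V(H(M)))$ where $H(M)\subseteq H$ is the unique subgraph such that this pair is a tidy $IM$. A ray is a one-way infinite path. -}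

module Defs where

open import Data.Nat using (ℕ; suc)
open import Data.Product using (Σ; _×_; _,_; ∃)
open import Data.Sum using (_⊎_)
open import Relation.Nullary using (¬_)
open import Relation.Binary.PropositionalEquality using (_≡_; _≢_)
open import Data.Unit using (⊤)
open import Function using (_⇔_)

record Graph : Set₁ where
  field
    V     : Set
    E     : V → V → Set
    E-sym : ∀ {x y} → E x y → E y x
    E-irr : ∀ {x} → ¬ E x x
open Graph public

record Sub (G : Graph) : Set₁ where
  field
    VS    : V G → Set
    ES    : V G → V G → Set
    ES-E  : ∀ {x y} → ES x y → E G x y
    ES-V  : ∀ {x y} → ES x y → VS x × VS y
    ES-sym : ∀ {x y} → ES x y → ES y x
open Sub public

full : (G : Graph) → Sub G
full G = record
  { VS = λ _ → ⊤ ; ES = E G ; ES-E = λ e → e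
  ; ES-V = λ _ → _ , _ ; ES-sym = E-sym G }

_⊆_ : ∀ {G} → Sub G → Sub G → Set
A ⊆ B = (∀ x → VS A x → VS B x) × (∀ x y → ES A x y → ES B x y)

-- Proper inclusion: A ⊆ B and A ≠ B (equality of subgraphs = equal vertex
-- and edge sets, i.e. mutual inclusion).
_⊊_ : ∀ {G} → Sub G → Sub G → Set
A ⊊ B = A ⊆ B × ¬ (B ⊆ A)

-- Walks in the subgraph B all of whose vertices (after the first) satisfy P.
data WalkIn {H : Graph} (B : Sub H) (P : V H → Set) : V H → V H → Set where
  here : ∀ {x} → WalkIn B P x x
  step : ∀ {x y z} → ES B x y → P y → WalkIn B P y z → WalkIn B P x z

-- (B , φ restricted to V(B)) is an inflated copy of the graph A (A ⊆ G, B ⊆ H).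
record IsInflated {G H : Graph} (A : Sub G) (B : Sub H) (φ : V H → V G) : Set where
  field
    maps      : ∀ x → VS B x → VS A (φ x)
    nonempty  : ∀ v → VS A v → Σ (V H) λ x → VS B x × φ x ≡ v
    connected : ∀ x y → VS B x → VS B y → φ x ≡ φ y →
                WalkIn B (λ z → VS B z × φ z ≡ φ x) x y
    edges     : ∀ v w → VS A v → VS A w → v ≢ w →
                ES A v w ⇔ (Σ (V H) λ x → Σ (V H) λ y → ES B x y × φ x ≡ v × φ y ≡ w)
    unique    : ∀ x y x′ y′ → ES B x y → ES B x′ y′ → φ x ≢ φ y →
                φ x ≡ φ x′ → φ y ≡ φ y′ → x ≡ x′ × y ≡ y′

record IsTidy {G H : Graph} (A : Sub G) (B : Sub H) (φ : V H → V G) : Set₁ where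
  field
    inflated : IsInflated A B φ
    minimal  : ∀ (B′ : Sub H) → B′ ⊊ B → ¬ IsInflated A B′ φ

TidyIG : (G H : Graph) → (V H → V G) → Set₁
TidyIG G H φ = IsTidy (full G) (full H) φ

IsRay : ∀ {G} → Sub G → Set
IsRay {G} R = Σ (ℕ → V G) λ f →
    (∀ m n → f m ≡ f n → m ≡ n)
  × (∀ x → VS R x ⇔ ∃ λ n → f n ≡ x)
  × (∀ x y → ES R x y ⇔ ∃ λ n → (f n ≡ x × f (suc n) ≡ y) ⊎ (f (suc n) ≡ x × f n ≡ y))

-- Let R = r₀ r₁ r₂ …. For every k, H(R) has an edge from the branch set
-- H(r_k) to H(r_{k+1}), and H(r_k) is connected; so we can walk through H(R)
-- branch set by branch set, inside H(r_k) along a shortest walk towards the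
-- edge leaving it. The walk visits every branch set and never repeats a vertex
-- (the branch index never drops, and within a branch set the distance to the
-- exit strictly decreases), so the vertices and edges it uses form a ray which
-- is again an inflated copy of R contained in H(R). By tidiness it is all of
-- H(R). Excluded middle is used twice: to pick shortest walks, and to turn the
-- minimality of H(R) into the inclusion H(R) ⊆ trail.
module Submission where

open import Defs
open import Level using (0ℓ)
open import Axiom.ExcludedMiddle using (ExcludedMiddle)
open import Data.Nat using (ℕ; zero; suc; _≤_; _<_; _>_; _≤′_; ≤′-refl; ≤′-step; s≤s)
open import Data.Nat.Properties
  using (≤-refl; ≤-reflexive; ≤-trans; ≤-antisym; ≤-total; <⇒≤; <-irrefl; <-trans;
         <-resp₂-≡; <-cmp; ≮⇒≥; ≤⇒≤′; ≤′⇒≤; m≤n⇒m<n∨m≡n; m≤n⇒m≤1+n; n<1+n)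
open import Data.Nat.Induction using (<-wellFounded)
open import Induction.WellFounded using (Acc; acc)
open import Data.Product using (Σ; _×_; _,_; ∃; proj₁; proj₂)
open import Data.Product.Relation.Binary.Lex.Strict using (×-Lex; ×-transitive; ×-irreflexive)
open import Data.Sum using (_⊎_; inj₁; inj₂)
open import Data.Empty using (⊥-elim)
open import Relation.Nullary using (yes; no; contradiction)
open import Relation.Binary.Core using (Rel)
open import Relation.Binary.Definitions using (Transitive; Irreflexive; tri<; tri≈; tri>)
open import Relation.Binary.PropositionalEquality
open import Function using (id)
open import Function.Bundles using (Equivalence; _⇔_; mk⇔)

module _ {a ℓ} {A : Set a} {_≺_ : Rel A ℓ} (≺-trans : Transitive _≺_)
         (s : ℕ → A) (s-step : ∀ n → s n ≺ s (suc n)) where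

  increasing : ∀ {m n} → m < n → s m ≺ s n
  increasing {m} m<n = go (≤⇒≤′ m<n)
    where
    go : ∀ {n} → suc m ≤′ n → s m ≺ s n
    go ≤′-refl         = s-step m
    go (≤′-step {n} p) = ≺-trans (go p) (s-step n)

  increasing⇒injective : Irreflexive _≡_ _≺_ → ∀ m n → s m ≡ s n → m ≡ n
  increasing⇒injective irr m n eq with <-cmp m n
  ... | tri< m<n _ _ = contradiction (increasing m<n) (irr eq)
  ... | tri≈ _ m≡n _ = m≡n
  ... | tri> _ _ n<m = contradiction (increasing n<m) (irr (sym eq))

least : ExcludedMiddle 0ℓ → (Q : ℕ → Set) → ∃ Q → Σ ℕ λ m → Q m × (∀ {n} → Q n → m ≤ n)
least lem Q (n , q) = go n (<-wellFounded n) q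
  where
  go : ∀ n → Acc _<_ n → Q n → Σ ℕ λ m → Q m × (∀ {n} → Q n → m ≤ n)
  go n (acc rs) q with lem {Σ ℕ λ j → Q j × j < n}
  ... | yes (j , qj , j<n) = go j (rs j<n) qj
  ... | no ¬smaller        = n , q , λ {j} qj → ≮⇒≥ (λ j<n → ¬smaller (j , qj , j<n))

module _ {H : Graph} {B : Sub H} where

  length : ∀ {P x y} → WalkIn B P x y → ℕ
  length here         = 0
  length (step _ _ w) = suc (length w)

  WalkIn-map : ∀ {P Q x y} → (∀ {z} → P z → Q z) → WalkIn B P x y → WalkIn B Q x y
  WalkIn-map g here         = here
  WalkIn-map g (step e p w) = step e (g p) (WalkIn-map g w)

  WalkIn-snoc : ∀ {P x y z} → WalkIn B P x y → ES B y z → P z → WalkIn B P x z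
  WalkIn-snoc here         e p = step e p here
  WalkIn-snoc (step f q w) e p = step f q (WalkIn-snoc w e p)

  WalkIn-reverse : ∀ {P x y} → P x → WalkIn B P x y → WalkIn B P y x
  WalkIn-reverse px here         = here
  WalkIn-reverse px (step e p w) = WalkIn-snoc (WalkIn-reverse p w) (ES-sym B e) px

module Geodesic (lem : ExcludedMiddle 0ℓ) {H : Graph} (B : Sub H) (P : V H → Set) (z : V H) where

  Reach : V H → ℕ → Set
  Reach x n = Σ (WalkIn B P x z) λ w → length w ≡ n

  dist : V H → ℕ
  dist x with lem {∃ (Reach x)}
  ... | yes reach = proj₁ (least lem (Reach x) reach)
  ... | no _      = 0

  dist-shortest : ∀ {x} → WalkIn B P x z → Reach x (dist x) × (∀ {n} → Reach x n → dist x ≤ n)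
  dist-shortest {x} w with lem {∃ (Reach x)}
  ... | yes reach = proj₂ (least lem (Reach x) reach)
  ... | no ¬reach = contradiction (_ , w , refl) ¬reach

  approach : ∀ {x} → WalkIn B P x z →
             x ≡ z ⊎ Σ (V H) λ x′ → ES B x x′ × P x′ × dist x′ < dist x
  approach w with dist-shortest w
  ... | (here , _) , _               = inj₁ refl
  ... | (step e p w′ , |w|≡dist) , _ =
    inj₂ (_ , e , p , subst (_ <_) |w|≡dist (s≤s (proj₂ (dist-shortest w′) (w′ , refl))))

IsRay-⊆⊇ : ∀ {G} {A B : Sub G} → A ⊆ B → B ⊆ A → IsRay A → IsRay B
IsRay-⊆⊇ (A⊆B , EA⊆EB) (B⊆A , EB⊆EA) (f , f-inj , vs , es) =
  f , f-inj
  , (λ x → mk⇔ (λ b → Equivalence.to (vs x) (B⊆A x b))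
               (λ n → A⊆B x (Equivalence.from (vs x) n)))
  , (λ x y → mk⇔ (λ e → Equivalence.to (es x y) (EB⊆EA x y e))
                 (λ n → EA⊆EB x y (Equivalence.from (es x y) n)))

module Trail {H : Graph} (S : Sub H) (f : ℕ → V H) (f-edge : ∀ n → ES S (f n) (f (suc n))) where

  Consecutive : V H → V H → Set
  Consecutive x y = ∃ λ n → (f n ≡ x × f (suc n) ≡ y) ⊎ (f (suc n) ≡ x × f n ≡ y)

  Consecutive⇒ES : ∀ {x y} → Consecutive x y → ES S x y
  Consecutive⇒ES (n , inj₁ (refl , refl)) = f-edge n
  Consecutive⇒ES (n , inj₂ (refl , refl)) = ES-sym S (f-edge n)

  trail : Sub H
  trail = record
    { VS     = λ x → ∃ λ n → f n ≡ x
    ; ES     = Consecutive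
    ; ES-E   = λ e → ES-E S (Consecutive⇒ES e)
    ; ES-V   = λ { (n , inj₁ (refl , refl)) → (n , refl) , (suc n , refl)
                 ; (n , inj₂ (refl , refl)) → (suc n , refl) , (n , refl) }
    ; ES-sym = λ { (n , inj₁ (p , q)) → n , inj₂ (q , p)
                 ; (n , inj₂ (p , q)) → n , inj₁ (q , p) } }

  trail⊆ : (∀ n → VS S (f n)) → trail ⊆ S
  trail⊆ f∈S = (λ { _ (n , refl) → f∈S n }) , (λ _ _ → Consecutive⇒ES)

  trail-isRay : (∀ m n → f m ≡ f n → m ≡ n) → IsRay trail
  trail-isRay f-inj = f , f-inj , (λ x → mk⇔ id id) , (λ x y → mk⇔ id id)

  trail-walk : ∀ (Q : V H → Set) {i j} → i ≤ j → (∀ {m} → i ≤ m → m ≤ j → Q (f m)) →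
               WalkIn trail (λ v → VS trail v × Q v) (f i) (f j)
  trail-walk Q {i} i≤j Qs = go (≤⇒≤′ i≤j) Qs
    where
    go : ∀ {j} → i ≤′ j → (∀ {m} → i ≤ m → m ≤ j → Q (f m)) →
         WalkIn trail (λ v → VS trail v × Q v) (f i) (f j)
    go ≤′-refl         _  = here
    go (≤′-step {j} p) Qs =
      WalkIn-snoc (go p (λ i≤m m≤j → Qs i≤m (m≤n⇒m≤1+n m≤j)))
                  (j , inj₁ (refl , refl))
                  ((suc j , refl) , Qs (m≤n⇒m≤1+n (≤′⇒≤ p)) ≤-refl)

tidy⇒⊆-inflated : ExcludedMiddle 0ℓ → ∀ {G H} {A : Sub G} {B B′ : Sub H} {φ : V H → V G} →
                  IsTidy A B φ → B′ ⊆ B → IsInflated A B′ φ → B ⊆ B′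
tidy⇒⊆-inflated lem {B = B} {B′} tidy B′⊆B inflated with lem {B ⊆ B′}
... | yes B⊆B′ = B⊆B′
... | no B⊈B′  = ⊥-elim (IsTidy.minimal tidy B′ (B′⊆B , B⊈B′) inflated)

module Pullback (lem : ExcludedMiddle 0ℓ) {G H : Graph} (φ : V H → V G)
  {R : Sub G} (ray : IsRay R) {HR : Sub H} (tidy : IsTidy R HR φ) where

  open IsInflated (IsTidy.inflated tidy)

  r : ℕ → V G
  r = proj₁ ray

  r-injective : ∀ m n → r m ≡ r n → m ≡ n
  r-injective = proj₁ (proj₂ ray)

  VS-R : ∀ v → VS R v ⇔ (∃ λ k → r k ≡ v)
  VS-R = proj₁ (proj₂ (proj₂ ray))

  ES-R : ∀ v w → ES R v w ⇔ (∃ λ k → (r k ≡ v × r (suc k) ≡ w) ⊎ (r (suc k) ≡ v × r k ≡ w))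
  ES-R = proj₂ (proj₂ (proj₂ ray))

  r∈R : ∀ k → VS R (r k)
  r∈R k = Equivalence.from (VS-R (r k)) (k , refl)

  Branch : ℕ → V H → Set
  Branch k x = VS HR x × φ x ≡ r k

  crossing : ∀ k → Σ (V H) λ x → Σ (V H) λ y → ES HR x y × φ x ≡ r k × φ y ≡ r (suc k)
  crossing k = Equivalence.to (edges _ _ (r∈R k) (r∈R (suc k)) r-k≢r-1+k)
                              (Equivalence.from (ES-R _ _) (k , inj₁ (refl , refl)))
    where
    r-k≢r-1+k : r k ≢ r (suc k)
    r-k≢r-1+k eq = <-irrefl (r-injective _ _ eq) (n<1+n k)

  exit enter : ℕ → V H
  exit k  = proj₁ (crossing k)
  enter k = proj₁ (proj₂ (crossing k))

  exit-enter : ∀ k → ES HR (exit k) (enter k)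
  exit-enter k = proj₁ (proj₂ (proj₂ (crossing k)))

  exit∈ : ∀ k → Branch k (exit k)
  exit∈ k = proj₁ (ES-V HR (exit-enter k)) , proj₁ (proj₂ (proj₂ (proj₂ (crossing k))))

  enter∈ : ∀ k → Branch (suc k) (enter k)
  enter∈ k = proj₂ (ES-V HR (exit-enter k)) , proj₂ (proj₂ (proj₂ (proj₂ (crossing k))))

  toExit : ∀ {k x} → Branch k x → WalkIn HR (Branch k) x (exit k)
  toExit {k} (x∈ , φx) =
    WalkIn-map (λ (v∈ , φv) → v∈ , trans φv φx)
               (connected _ _ x∈ (proj₁ (exit∈ k)) (trans φx (sym (proj₂ (exit∈ k)))))

  module Toward (k : ℕ) = Geodesic lem HR (Branch k) (exit k)

  Position : Set
  Position = Σ ℕ λ k → Σ (V H) (Branch k)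

  index : Position → ℕ
  index (k , _ , _) = k

  vertex : Position → V H
  vertex (_ , x , _) = x

  height : Position → ℕ
  height (k , x , _) = Toward.dist k x

  data _⟶_ : Position → Position → Set where
    approach : ∀ {k x x′} {b : Branch k x} {b′ : Branch k x′} →
               ES HR x x′ → Toward.dist k x′ < Toward.dist k x → (k , x , b) ⟶ (k , x′ , b′)
    cross    : ∀ {k} {b : Branch k (exit k)} → (k , exit k , b) ⟶ (suc k , enter k , enter∈ k)

  -- Only the type of advance is ever needed; unfolding it makes type checking blow up.
  opaque
    advance : (p : Position) → Σ Position (p ⟶_)
    advance (k , x , b) with Toward.approach k (toExit b)
    ... | inj₁ refl                  = _ , cross
    ... | inj₂ (_ , e , b′ , closer) = _ , approach {b′ = b′} e closer

  ⟶-edge : ∀ {p p′} → p ⟶ p′ → ES HR (vertex p) (vertex p′)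
  ⟶-edge (approach e _) = e
  ⟶-edge cross          = exit-enter _

  ⟶-cases : ∀ {p p′} → p ⟶ p′ →
            (index p′ ≡ index p × height p′ < height p) ⊎ index p′ ≡ suc (index p)
  ⟶-cases (approach _ closer) = inj₁ (refl , closer)
  ⟶-cases cross               = inj₂ refl

  walk : ℕ → Position
  walk zero    = 0 , exit 0 , exit∈ 0
  walk (suc n) = proj₁ (advance (walk n))

  walk-step : ∀ n → walk n ⟶ walk (suc n)
  walk-step n = proj₂ (advance (walk n))

  f : ℕ → V H
  f n = vertex (walk n)

  idx : ℕ → ℕ
  idx n = index (walk n)

  f∈ : ∀ n → Branch (idx n) (f n)
  f∈ n = proj₂ (proj₂ (walk n))

  f-edge : ∀ n → ES HR (f n) (f (suc n))
  f-edge n = ⟶-edge (walk-step n)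

  _⊏_ : Rel (ℕ × ℕ) 0ℓ
  _⊏_ = ×-Lex _≡_ _<_ _>_

  ⊏-trans : Transitive _⊏_
  ⊏-trans = ×-transitive {_<₂_ = _>_} isEquivalence <-resp₂-≡ <-trans (λ p q → <-trans q p)

  ⊏-irrefl : Irreflexive _≡_ _⊏_
  ⊏-irrefl eq = ×-irreflexive {_<₁_ = _<_} {_<₂_ = _>_} <-irrefl (λ eq′ → <-irrefl (sym eq′))
                              (cong proj₁ eq , cong proj₂ eq)

  measure : ℕ → ℕ × ℕ
  measure n = idx n , height (walk n)

  measure-step : ∀ n → measure n ⊏ measure (suc n)
  measure-step n with ⟶-cases (walk-step n)
  ... | inj₁ (same , lower) = inj₂ (sym same , lower)
  ... | inj₂ next           = inj₁ (subst (idx n <_) (sym next) (n<1+n _))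

  idx-monotone : ∀ {m n} → m ≤ n → idx m ≤ idx n
  idx-monotone m≤n with m≤n⇒m<n∨m≡n m≤n
  ... | inj₂ refl = ≤-refl
  ... | inj₁ m<n with increasing {_≺_ = _⊏_} ⊏-trans measure measure-step m<n
  ...   | inj₁ lt       = <⇒≤ lt
  ...   | inj₂ (eq , _) = ≤-reflexive eq

  φ-determines-idx : ∀ m n → φ (f m) ≡ φ (f n) → idx m ≡ idx n
  φ-determines-idx m n eq = r-injective _ _ (trans (sym (proj₂ (f∈ m))) (trans eq (proj₂ (f∈ n))))

  f-injective : ∀ m n → f m ≡ f n → m ≡ n
  f-injective m n eq = increasing⇒injective ⊏-trans measure measure-step ⊏-irrefl m n
    (cong₂ _,_ same (cong₂ Toward.dist same eq))
    where
    same : idx m ≡ idx n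
    same = φ-determines-idx m n (cong φ eq)

  leaves : ∀ n → Acc _<_ (height (walk n)) →
           Σ ℕ λ q → idx q ≡ idx n × idx (suc q) ≡ suc (idx n)
  leaves n (acc rs) with ⟶-cases (walk-step n)
  ... | inj₂ crossed           = n , refl , crossed
  ... | inj₁ (stays , closer) with leaves (suc n) (rs closer)
  ...   | q , at , crossed = q , trans at stays , trans crossed (cong suc stays)

  crossing-time : ∀ k → Σ ℕ λ q → idx q ≡ k × idx (suc q) ≡ suc k
  crossing-time zero    = leaves 0 (<-wellFounded _)
  crossing-time (suc k) with crossing-time k
  ... | q , _ , entered with leaves (suc q) (<-wellFounded _)
  ...   | q′ , at , crossed = q′ , trans at entered , trans crossed (cong suc entered)

  open Trail HR f f-edge

  same-branch-between : ∀ {i j m} → idx i ≡ idx j → i ≤ m → m ≤ j → φ (f m) ≡ φ (f i)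
  same-branch-between {i} {j} {m} eq i≤m m≤j =
    trans (proj₂ (f∈ m)) (trans (cong r idx-m≡idx-i) (sym (proj₂ (f∈ i))))
    where
    idx-m≡idx-i : idx m ≡ idx i
    idx-m≡idx-i = ≤-antisym (≤-trans (idx-monotone m≤j) (≤-reflexive (sym eq))) (idx-monotone i≤m)

  trail-connected : ∀ x y → VS trail x → VS trail y → φ x ≡ φ y →
                    WalkIn trail (λ v → VS trail v × φ v ≡ φ x) x y
  trail-connected _ _ (i , refl) (j , refl) φ≡ with ≤-total i j
  ... | inj₁ i≤j =
    trail-walk (λ v → φ v ≡ φ (f i)) i≤j (same-branch-between (φ-determines-idx i j φ≡))
  ... | inj₂ j≤i =
    WalkIn-reverse ((j , refl) , sym φ≡)
      (trail-walk (λ v → φ v ≡ φ (f i)) j≤i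
        (λ j≤m m≤i → trans (same-branch-between (φ-determines-idx j i (sym φ≡)) j≤m m≤i) (sym φ≡)))

  crossing-edge : ∀ k → Σ ℕ λ q → φ (f q) ≡ r k × φ (f (suc q)) ≡ r (suc k)
  crossing-edge k with crossing-time k
  ... | q , at , crossed =
    q , trans (proj₂ (f∈ q)) (cong r at) , trans (proj₂ (f∈ (suc q))) (cong r crossed)

  trail-nonempty : ∀ v → VS R v → Σ (V H) λ x → VS trail x × φ x ≡ v
  trail-nonempty v v∈R with Equivalence.to (VS-R v) v∈R
  ... | k , refl with crossing-edge k
  ...   | q , φ-q , _ = f q , (q , refl) , φ-q

  trail-crosses : ∀ v w → (∃ λ k → (r k ≡ v × r (suc k) ≡ w) ⊎ (r (suc k) ≡ v × r k ≡ w)) →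
                  Σ (V H) λ x → Σ (V H) λ y → Consecutive x y × φ x ≡ v × φ y ≡ w
  trail-crosses _ _ (k , inj₁ (refl , refl)) with crossing-edge k
  ... | q , φ-q , φ-1+q = f q , f (suc q) , (q , inj₁ (refl , refl)) , φ-q , φ-1+q
  trail-crosses _ _ (k , inj₂ (refl , refl)) with crossing-edge k
  ... | q , φ-q , φ-1+q = f (suc q) , f q , (q , inj₂ (refl , refl)) , φ-1+q , φ-q

  trail-inflated : IsInflated R trail φ
  trail-inflated = record
    { maps      = λ { _ (n , refl) → maps (f n) (proj₁ (f∈ n)) }
    ; nonempty  = trail-nonempty
    ; connected = trail-connected
    ; edges     = λ v w v∈ w∈ v≢w → mk⇔
        (λ e → trail-crosses v w (Equivalence.to (ES-R v w) e))
        (λ (x , y , e , φx , φy) →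
           Equivalence.from (edges v w v∈ w∈ v≢w) (x , y , Consecutive⇒ES e , φx , φy))
    ; unique    = λ x y x′ y′ e e′ → unique x y x′ y′ (Consecutive⇒ES e) (Consecutive⇒ES e′) }

  trail⊆HR : trail ⊆ HR
  trail⊆HR = trail⊆ (λ n → proj₁ (f∈ n))

  isRay : IsRay HR
  isRay = IsRay-⊆⊇ {A = trail} {B = HR} trail⊆HR
                   (tidy⇒⊆-inflated lem tidy trail⊆HR trail-inflated)
                   (trail-isRay f-injective)

-- Only the minimality of H(R) is needed, not the tidiness of H.
lemma2p7 : ExcludedMiddle 0ℓ →
    (G H : Graph) (φ : V H → V G) → TidyIG G H φ →
    (R : Sub G) → IsRay R →
    (HR : Sub H) → IsTidy R HR φ → IsRay HR
lemma2p7 lem G H φ _ R ray HR tidy = Pullback.isRay lem φ ray tidy
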